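{- Let $n\ge 2$ and let $k_1,\dots,k_n\ge 3$ be integers. Let $\mathcal{H}_{\{k_1-1,\dots,k_n-1\}}$ be the hinge graph obtained by gluing cycle graphs with $k_1,\dots,k_n$ vertices along one common edge $xy$, and let $\delta_{x,y}$ be the divisor assigning $1$ to one of the shared vertices $x,y$, $-1$ to the other, and $0$ elsewhere. Put $b:=\operatorname{lcm}(k_1-1,\dots,k_n-1)$. Then the order of $\delta_{x,y}$ in the critical group is $$|\delta_{x,y}| = b + \frac{b}{k_1-1} + \frac{b}{k_2-1} + \cdots + \frac{b}{k_n-1}.$$
   Context: The hinge graph $\mathcal{H}_{\{k_1-1,\dots,k_n-1\}}$ is the simple graph with two distinguished ("shared") vertices $x,y$ joined by an edge $xy$, together with $n$ internally vertex-disjoint paths from $x$ to $y$, the $i$-th path having $k_i-2$ internal vertices. A divisor is a formal $\mathbb{Z}$-linear combination of vertices; two divisors are linearly equivalent if their difference lies in the image of the graph Laplacian (equivalently, one is obtained from the other by chip-firing moves, where firing a vertex $w$ decreases its value by its valence and increases each neighbor's value by $1$). The order of a degree-zero divisor $D$ is the smallest positive integer $z$ such that $zD$ is linearly equivalent to the zero divisor. -}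

module Defs where

open import Data.Nat as ℕ using (ℕ; zero; suc; _≤_; _<_; NonZero; s≤s; z≤n)
open import Data.Nat.LCM using (lcm)
open import Data.Integer as ℤ using (ℤ; +_; -[1+_]; _-_; _+_; _*_; 0ℤ; 1ℤ)
open import Data.Fin using (Fin; zero; suc; fromℕ)
open import Data.List using (List; []; _∷_; map; foldr; allFin)
open import Data.Product using (Σ; ∃; _×_; _,_)
open import Relation.Binary.PropositionalEquality using (_≡_)
open import Relation.Nullary using (¬_)
open import Function using (_∘_)

-- Generic chip-firing notions for a finite graph given by neighbour lists
-- (the neighbour list of v lists each neighbour once per edge).

module ChipFiring {V : Set} (nbrs : V → List V) where

  Divisor : Set
  Divisor = V → ℤ

  laplacian : (V → ℤ) → Divisor
  laplacian f v = foldr (λ w acc → (f v - f w) + acc) 0ℤ (nbrs v)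

  _∼_ : Divisor → Divisor → Set
  D ∼ D' = ∃ λ (f : V → ℤ) → ∀ v → D v - D' v ≡ laplacian f v

  zeroDiv : Divisor
  zeroDiv _ = 0ℤ

  _·_ : ℕ → Divisor → Divisor
  (z · D) v = (+ z) * D v

  IsOrder : Divisor → ℕ → Set
  IsOrder D z = (0 < z) × ((z · D) ∼ zeroDiv)
              × (∀ m → 0 < m → (m · D) ∼ zeroDiv → z ≤ m)

-- Hinge graph H_{k_1-1,...,k_n-1}: shared vertices x, y joined by an edge,
-- plus for each i a path x - inner i 0 - ... - inner i (k i - 3) - y
-- with k i - 2 internal vertices (so path + edge xy is a k_i-cycle).

module Hinge (n : ℕ) (k : Fin n → ℕ) where

  len : Fin n → ℕ
  len i = k i ℕ.∸ 2

  data Vertex : Set where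
    vx vy : Vertex
    inner : (i : Fin n) → Fin (len i) → Vertex

  prevOf : ∀ {m} → Fin m → (Fin m → Vertex) → Vertex
  prevOf zero    g = vx
  prevOf (suc j) g = g (Data.Fin.inject₁ j)

  nextOf : ∀ {m} → Fin m → (Fin m → Vertex) → Vertex
  nextOf {suc zero}    zero    g = vy
  nextOf {suc (suc m)} zero    g = g (suc zero)
  nextOf {suc (suc m)} (suc j) g = nextOf {suc m} j (g ∘ suc)

  firstOf : ∀ {m} → (Fin m → Vertex) → Vertex
  firstOf {zero}  g = vy
  firstOf {suc m} g = g zero

  lastOf : ∀ {m} → (Fin m → Vertex) → Vertex
  lastOf {zero}  g = vx
  lastOf {suc m} g = g (fromℕ m)

  nbrs : Vertex → List Vertex
  nbrs vx          = vy ∷ map (λ i → firstOf (inner i)) (allFin n)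
  nbrs vy          = vx ∷ map (λ i → lastOf (inner i)) (allFin n)
  nbrs (inner i j) = prevOf j (inner i) ∷ nextOf j (inner i) ∷ []

  open ChipFiring nbrs public

  δxy : Divisor
  δxy vx          = 1ℤ
  δxy vy          = ℤ.-[1+ 0 ]
  δxy (inner _ _) = 0ℤ

lcmFin : (n : ℕ) → (Fin n → ℕ) → ℕ
lcmFin n a = foldr lcm 1 (map a (allFin n))

sumFin : (n : ℕ) → (Fin n → ℕ) → ℕ
sumFin n a = foldr ℕ._+_ 0 (map a (allFin n))

pred-nonZero : ∀ {m} → 3 ≤ m → NonZero (m ℕ.∸ 1)
pred-nonZero (s≤s (s≤s (s≤s _))) = _

{-# OPTIONS --safe #-}
-- If laplacian g = m · δxy, then g is harmonic at the inner vertices, hence affine along each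
-- path: writing c i = k i - 1 and s i for the drop of g along the first edge of path i,
-- g x - g y = c i * s i for every i, and m = (g x - g y) + Σ s i.  So g x - g y is a common
-- multiple of the c i, positive because m is; it is therefore at least b = lcm c, and then
-- s i ≥ b / c i.  The potential with g x - g y = b and slopes b / c i attains this bound.
module Submission where

open import Defs
open import Data.Nat as ℕ using (ℕ; zero; suc; _≤_; _<_; _/_; NonZero; z≤n)
import Data.Nat.Properties as ℕₚ
open import Data.Nat.Divisibility using (_∣_; divides; ∣-trans; 1∣_; ∣⇒≤)
open import Data.Nat.DivMod using (m*[n/m]≡n)
open import Data.Nat.GCD using (gcd)
open import Data.Nat.LCM using (lcm; m∣lcm[m,n]; n∣lcm[m,n]; lcm-least; gcd*lcm)
open import Data.Nat.ListAction using (sum)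
open import Data.Integer as ℤ using (ℤ; +_; -[1+_]; 0ℤ; ∣_∣)
import Data.Integer.Properties as ℤₚ
open import Data.Integer.Tactic.RingSolver using (solve-∀)
open import Data.Fin using (Fin; zero; suc; toℕ; inject₁; fromℕ)
open import Data.Fin.Properties using (toℕ-inject₁; toℕ-fromℕ)
open import Data.List using (List; []; _∷_; map; foldr; allFin)
open import Data.List.Properties using (foldr-map)
open import Data.List.Membership.Propositional using (_∈_)
open import Data.List.Membership.Propositional.Properties using (∈-allFin)
open import Data.List.Relation.Unary.Any using (here; there)
open import Data.Product using (_,_)
open import Data.Empty using (⊥-elim)
open import Function using (_∘_)
open import Relation.Binary.PropositionalEquality
open import Relation.Nullary using (contradiction)

module _ {A : Set} (a : A → ℕ) where
  open import Data.Nat using (_+_; _*_)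

  lcmOf : List A → ℕ
  lcmOf xs = foldr lcm 1 (map a xs)

  ∣lcmOf : ∀ {x xs} → x ∈ xs → a x ∣ lcmOf xs
  ∣lcmOf {xs = x ∷ xs} (here refl) = m∣lcm[m,n] (a x) (lcmOf xs)
  ∣lcmOf {xs = y ∷ xs} (there x∈xs) = ∣-trans (∣lcmOf x∈xs) (n∣lcm[m,n] (a y) (lcmOf xs))

  lcmOf-least : ∀ {m} → (∀ x → a x ∣ m) → ∀ xs → lcmOf xs ∣ m
  lcmOf-least {m} a∣m []       = 1∣ m
  lcmOf-least     a∣m (x ∷ xs) = lcm-least (a∣m x) (lcmOf-least a∣m xs)

  lcmOf-nonZero : (∀ x → NonZero (a x)) → ∀ xs → NonZero (lcmOf xs)
  lcmOf-nonZero a≢0 []       = _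
  lcmOf-nonZero a≢0 (x ∷ xs) = ℕ.≢-nonZero lcm≢0
    where
    open ≡-Reasoning
    l : ℕ
    l = lcmOf xs
    lcm≢0 : lcm (a x) l ≢ 0
    lcm≢0 lcm≡0 = ℕ.≢-nonZero⁻¹ (a x * l) {{ℕₚ.m*n≢0 (a x) l {{a≢0 x}} {{lcmOf-nonZero a≢0 xs}}}} (begin
      a x * l                  ≡⟨ gcd*lcm (a x) l ⟨
      gcd (a x) l * lcm (a x) l ≡⟨ cong (gcd (a x) l *_) lcm≡0 ⟩
      gcd (a x) l * 0          ≡⟨ ℕₚ.*-zeroʳ (gcd (a x) l) ⟩
      0                        ∎)

  sum-mono : ∀ {b : A → ℕ} → (∀ x → a x ≤ b x) → ∀ xs → sum (map a xs) ≤ sum (map b xs)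
  sum-mono a≤b []       = z≤n
  sum-mono a≤b (x ∷ xs) = ℕₚ.+-mono-≤ (a≤b x) (sum-mono a≤b xs)

  sum-≡0 : (∀ x → a x ≡ 0) → ∀ xs → sum (map a xs) ≡ 0
  sum-≡0 a≡0 []       = refl
  sum-≡0 a≡0 (x ∷ xs) = cong₂ _+_ (a≡0 x) (sum-≡0 a≡0 xs)

module _ {A : Set} where
  open import Data.Integer using (_+_; -_)

  sumℤ : (A → ℤ) → List A → ℤ
  sumℤ t = foldr (λ x acc → t x + acc) 0ℤ

  sumℤ-pos : ∀ {t : A → ℤ} {u : A → ℕ} → (∀ x → t x ≡ + u x) → ∀ xs → sumℤ t xs ≡ + sum (map u xs)
  sumℤ-pos t≡u []       = refl
  sumℤ-pos t≡u (x ∷ xs) = cong₂ _+_ (t≡u x) (sumℤ-pos t≡u xs)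

  sumℤ-neg : ∀ {t : A → ℤ} {u : A → ℕ} → (∀ x → t x ≡ - + u x) → ∀ xs → sumℤ t xs ≡ - + sum (map u xs)
  sumℤ-neg t≡-u []       = refl
  sumℤ-neg {t} {u} t≡-u (x ∷ xs) = begin
    t x + sumℤ t xs                 ≡⟨ cong₂ _+_ (t≡-u x) (sumℤ-neg t≡-u xs) ⟩
    - + u x + - + sum (map u xs)    ≡⟨ ℤₚ.neg-distrib-+ (+ u x) (+ sum (map u xs)) ⟨
    - (+ u x + + sum (map u xs))    ∎
    where open ≡-Reasoning

module _ where
  open import Data.Integer using (_+_; _-_; _*_; -_; 1ℤ)

  +c*d≡+a⇒d≡+∣d∣ : ∀ {c d a} → NonZero c → + c * d ≡ + a → d ≡ + ∣ d ∣
  +c*d≡+a⇒d≡+∣d∣ {suc c} {+ x}      _ _  = refl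
  +c*d≡+a⇒d≡+∣d∣ {suc c} { -[1+ x ]} _ ()

  +c*d≡-[1+a]⇒d≡-∣d∣ : ∀ {c d a} → + c * d ≡ -[1+ a ] → d ≡ - + ∣ d ∣
  +c*d≡-[1+a]⇒d≡-∣d∣ {c} {+ x} cd<0 = contradiction (trans (ℤₚ.pos-* c x) cd<0) λ ()
  +c*d≡-[1+a]⇒d≡-∣d∣ {c} { -[1+ x ]} _ = refl

  equal-steps : ∀ a v w → (v - a) + ((v - w) + 0ℤ) ≡ 0ℤ → v - w ≡ a - v
  equal-steps a v w balanced = begin
    v - w                                     ≡⟨ isolate (v - a) (v - w) ⟩
    ((v - a) + ((v - w) + 0ℤ)) - (v - a)      ≡⟨ cong (_- (v - a)) balanced ⟩
    0ℤ - (v - a)                              ≡⟨ flip a v ⟩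
    a - v                                     ∎
    where
    open ≡-Reasoning
    isolate : ∀ x y → y ≡ (x + (y + 0ℤ)) - x
    isolate = solve-∀
    flip : ∀ a v → 0ℤ - (v - a) ≡ a - v
    flip = solve-∀

module LcmQuotients {n : ℕ} (c : Fin n → ℕ) (c≢0 : ∀ i → NonZero (c i)) where
  open import Data.Integer using (_+_; -_; _*_)

  b : ℕ
  b = lcmFin n c

  quot : Fin n → ℕ
  quot i = (b / c i) {{c≢0 i}}

  b≢0 : NonZero b
  b≢0 = lcmOf-nonZero c c≢0 (allFin n)

  b≡c*quot : ∀ i → b ≡ c i ℕ.* quot i
  b≡c*quot i = sym (m*[n/m]≡n {{c≢0 i}} (∣lcmOf c (∈-allFin i)))

  lcm+Σquot-≤ : ∀ {a} (e : Fin n → ℕ) → (∀ i → a ≡ c i ℕ.* e i) → 0 < a ℕ.+ sumFin n e →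
                    b ℕ.+ sumFin n quot ≤ a ℕ.+ sumFin n e
  lcm+Σquot-≤ {zero} e 0≡ce 0<Σe = ⊥-elim (ℕₚ.<-irrefl (sym (sum-≡0 e e≡0 (allFin n))) 0<Σe)
    where
    e≡0 : ∀ i → e i ≡ 0
    e≡0 i = ℕₚ.m*n≡0⇒m≡0 (e i) (c i) {{c≢0 i}} (trans (ℕₚ.*-comm (e i) (c i)) (sym (0≡ce i)))
  lcm+Σquot-≤ {suc a} e a≡ce _ = ℕₚ.+-mono-≤ b≤a (sum-mono quot quot≤e (allFin n))
    where
    b≤a : b ≤ suc a
    b≤a = ∣⇒≤ (lcmOf-least c (λ i → divides (e i) (trans (a≡ce i) (ℕₚ.*-comm (c i) (e i)))) (allFin n))
    quot≤e : ∀ i → quot i ≤ e i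
    quot≤e i = ℕₚ.*-cancelˡ-≤ (c i) {{c≢0 i}} (subst₂ _≤_ (b≡c*quot i) (a≡ce i) b≤a)

  -- Every d i has the sign of A, so A ≤ 0 would force m ≤ 0.
  lcm+Σquot-least : ∀ (A : ℤ) (d : Fin n → ℤ) {m} → (∀ i → A ≡ + c i * d i) →
                        + m ≡ A + sumℤ d (allFin n) → 0 < m → b ℕ.+ sumFin n quot ≤ m
  lcm+Σquot-least (+ a) d {m} A≡cd m≡A+Σd 0<m =
    subst (b ℕ.+ sumFin n quot ≤_) (sym m≡a+Σe) (lcm+Σquot-≤ e a≡ce (subst (0 <_) m≡a+Σe 0<m))
    where
    e : Fin n → ℕ
    e i = ∣ d i ∣
    d≡e : ∀ i → d i ≡ + e i
    d≡e i = +c*d≡+a⇒d≡+∣d∣ (c≢0 i) (sym (A≡cd i))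
    a≡ce : ∀ i → a ≡ c i ℕ.* e i
    a≡ce i = ℤₚ.+-injective (trans (A≡cd i) (trans (cong (+ c i *_) (d≡e i)) (sym (ℤₚ.pos-* (c i) (e i)))))
    m≡a+Σe : m ≡ a ℕ.+ sumFin n e
    m≡a+Σe = ℤₚ.+-injective (trans m≡A+Σd (cong (_+_ (+ a)) (sumℤ-pos d≡e (allFin n))))
  lcm+Σquot-least -[1+ a ] d A≡cd m≡A+Σd _ = contradiction (trans m≡A+Σd A+Σd<0) λ ()
    where
    e : Fin n → ℕ
    e i = ∣ d i ∣
    A+Σd<0 : -[1+ a ] + sumℤ d (allFin n) ≡ - + (suc a ℕ.+ sumFin n e)
    A+Σd<0 = trans (cong (_+_ -[1+ a ]) (sumℤ-neg (λ i → +c*d≡-[1+a]⇒d≡-∣d∣ {c i} (sym (A≡cd i))) (allFin n)))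
                   (sym (ℤₚ.neg-distrib-+ (+ suc a) (+ sumFin n e)))

module HingeDivisors (n : ℕ) (k : Fin n → ℕ) where
  open Hinge n k
  open import Data.Integer using (_+_; _-_; _*_; -_; 1ℤ)

  -- laplacian G v ≡ 0ℤ, written out for a vertex v with neighbours p and q
  Balanced : (Vertex → ℤ) → Vertex → Vertex → Vertex → Set
  Balanced G p v q = (G v - G p) + ((G v - G q) + 0ℤ) ≡ 0ℤ

  laplacian-vx : ∀ G → laplacian G vx ≡ (G vx - G vy) + sumℤ (λ i → G vx - G (firstOf (inner i))) (allFin n)
  laplacian-vx G = cong (_+_ (G vx - G vy)) (foldr-map _ (λ i → firstOf (inner i)) 0ℤ (allFin n))

  laplacian-vy : ∀ G → laplacian G vy ≡ (G vy - G vx) + sumℤ (λ i → G vy - G (lastOf (inner i))) (allFin n)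
  laplacian-vy G = cong (_+_ (G vy - G vx)) (foldr-map _ (λ i → lastOf (inner i)) 0ℤ (allFin n))

  multiple-δxy-vx : ∀ m → (m · δxy) vx - zeroDiv vx ≡ + m
  multiple-δxy-vx m = trans (ℤₚ.+-identityʳ (+ m * 1ℤ)) (ℤₚ.*-identityʳ (+ m))

  multiple-δxy-vy : ∀ m → (m · δxy) vy - zeroDiv vy ≡ - + m
  multiple-δxy-vy m = trans (ℤₚ.+-identityʳ (+ m * -[1+ 0 ])) (trans (ℤₚ.*-comm (+ m) -[1+ 0 ]) (ℤₚ.-1*i≡-i (+ m)))

  multiple-δxy-inner : ∀ m i j → (m · δxy) (inner i j) - zeroDiv (inner i j) ≡ 0ℤ
  multiple-δxy-inner m i j = trans (ℤₚ.+-identityʳ (+ m * 0ℤ)) (ℤₚ.*-zeroʳ (+ m))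

  -- prevOf with the start vertex vx generalised to u, so that the tail of a path is again a path
  prevFrom : ∀ {m} → Vertex → Fin m → (Fin m → Vertex) → Vertex
  prevFrom u zero    g = u
  prevFrom u (suc j) g = g (inject₁ j)

  prevOf≡prevFrom-vx : ∀ {m} (j : Fin m) (g : Fin m → Vertex) → prevOf j g ≡ prevFrom vx j g
  prevOf≡prevFrom-vx zero    g = refl
  prevOf≡prevFrom-vx (suc j) g = refl

  prevFrom-suc : ∀ {m} u (j : Fin m) (g : Fin (suc m) → Vertex) → prevFrom u (suc j) g ≡ prevFrom (g zero) j (g ∘ suc)
  prevFrom-suc u zero    g = refl
  prevFrom-suc u (suc j) g = refl

  nextOf-zero : ∀ {m} (g : Fin (suc m) → Vertex) → nextOf zero g ≡ firstOf (g ∘ suc)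
  nextOf-zero {zero}  g = refl
  nextOf-zero {suc m} g = refl

  nextOf-suc : ∀ {m} (j : Fin m) (g : Fin (suc m) → Vertex) → nextOf (suc j) g ≡ nextOf j (g ∘ suc)
  nextOf-suc {suc m} j g = refl

  balanced-path-drop : ∀ {m} (G : Vertex → ℤ) (u : Vertex) (g : Fin m → Vertex) →
                       (∀ j → Balanced G (prevFrom u j g) (g j) (nextOf j g)) →
                       G vy ≡ G u - + suc m * (G u - G (firstOf g))
  balanced-path-drop {zero} G u g _ = single-step (G u) (G vy)
    where
    single-step : ∀ a y → y ≡ a - 1ℤ * (a - y)
    single-step = solve-∀
  balanced-path-drop {suc m} G u g balanced = begin
    G vy                               ≡⟨ balanced-path-drop G (g zero) (g ∘ suc) tail-balanced ⟩
    G v - + suc m * (G v - G w)        ≡⟨ cong (λ t → G v - + suc m * t) first-steps-equal ⟩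
    G v - + suc m * (G u - G v)        ≡⟨ extend (G u) (G v) (+ suc m) ⟩
    G u - + suc (suc m) * (G u - G v)  ∎
    where
    open ≡-Reasoning
    v w : Vertex
    v = g zero
    w = firstOf (g ∘ suc)
    tail-balanced : ∀ j → Balanced G (prevFrom v j (g ∘ suc)) (g (suc j)) (nextOf j (g ∘ suc))
    tail-balanced j = subst₂ (λ p q → Balanced G p (g (suc j)) q) (prevFrom-suc u j g) (nextOf-suc j g) (balanced (suc j))
    first-steps-equal : G v - G w ≡ G u - G v
    first-steps-equal = equal-steps (G u) (G v) (G w) (subst (Balanced G u v) (nextOf-zero g) (balanced zero))
    extend : ∀ a x l → x - l * (a - x) ≡ a - (1ℤ + l) * (a - x)
    extend = solve-∀

  module _ (G : Vertex → ℤ) where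

    prevOf-value : ∀ {m} (H : ℕ → ℤ) (g : Fin m → Vertex) → G vx ≡ H 0 → (∀ j → G (g j) ≡ H (suc (toℕ j))) →
                   ∀ j → G (prevOf j g) ≡ H (toℕ j)
    prevOf-value H g at-vx at-g zero    = at-vx
    prevOf-value H g at-vx at-g (suc j) = trans (at-g (inject₁ j)) (cong (H ∘ suc) (toℕ-inject₁ j))

    nextOf-value : ∀ {m} (H : ℕ → ℤ) (g : Fin m → Vertex) → (∀ j → G (g j) ≡ H (suc (toℕ j))) → G vy ≡ H (suc m) →
                   ∀ j → G (nextOf j g) ≡ H (suc (suc (toℕ j)))
    nextOf-value {suc zero}    H g at-g at-vy zero    = at-vy
    nextOf-value {suc (suc m)} H g at-g at-vy zero    = at-g (suc zero)
    nextOf-value {suc (suc m)} H g at-g at-vy (suc j) = nextOf-value (H ∘ suc) (g ∘ suc) (at-g ∘ suc) at-vy j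

    firstOf-value : ∀ {m} (H : ℕ → ℤ) (g : Fin m → Vertex) → (∀ j → G (g j) ≡ H (suc (toℕ j))) → G vy ≡ H (suc m) →
                    G (firstOf g) ≡ H 1
    firstOf-value {zero}  H g at-g at-vy = at-vy
    firstOf-value {suc m} H g at-g at-vy = at-g zero

    lastOf-value : ∀ {m} (H : ℕ → ℤ) (g : Fin m → Vertex) → G vx ≡ H 0 → (∀ j → G (g j) ≡ H (suc (toℕ j))) →
                   G (lastOf g) ≡ H m
    lastOf-value {zero}  H g at-vx at-g = at-vx
    lastOf-value {suc m} H g at-vx at-g = trans (at-g (fromℕ m)) (cong (H ∘ suc) (toℕ-fromℕ m))

  module _ (h : ∀ i → 3 ≤ k i) where

    c : Fin n → ℕ
    c i = k i ℕ.∸ 1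

    open LcmQuotients c (λ i → pred-nonZero (h i))

    suc-len : ∀ i → suc (len i) ≡ c i
    suc-len i = trans (cong suc (sym (ℕₚ.pred[m∸n]≡m∸[1+n] (k i) 1))) (ℕₚ.suc-pred (c i) {{pred-nonZero (h i)}})

    b≡suc-len*quot : ∀ i → + b ≡ + suc (len i) * + quot i
    b≡suc-len*quot i = trans (cong +_ (trans (b≡c*quot i) (cong (ℕ._* quot i) (sym (suc-len i)))))
                             (ℤₚ.pos-* (suc (len i)) (quot i))

    -- Since c i * quot i = b, height i vanishes at position c i, i.e. at vy.
    height : Fin n → ℕ → ℤ
    height i p = + b - + p * + quot i

    potential : Vertex → ℤ
    potential vx          = + b
    potential vy          = 0ℤ
    potential (inner i j) = height i (suc (toℕ j))

    potential-vx : ∀ i → potential vx ≡ height i 0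
    potential-vx i = sym (ℤₚ.+-identityʳ (+ b))

    potential-vy : ∀ i → potential vy ≡ height i (suc (len i))
    potential-vy i = sym (trans (cong (_- (+ suc (len i) * + quot i)) (b≡suc-len*quot i))
                                (ℤₚ.+-inverseʳ (+ suc (len i) * + quot i)))

    potential-inner : ∀ i j → potential (inner i j) ≡ height i (suc (toℕ j))
    potential-inner i j = refl

    order : ℕ
    order = b ℕ.+ sumFin n quot

    first-edge-drop : ∀ i → potential vx - potential (firstOf (inner i)) ≡ + quot i
    first-edge-drop i = trans (cong (_-_ (+ b)) (firstOf-value potential (height i) (inner i) (potential-inner i) (potential-vy i)))
                                (first-step (+ b) (+ quot i))
      where
      first-step : ∀ a s → a - (a - 1ℤ * s) ≡ s
      first-step = solve-∀

    last-edge-drop : ∀ i → potential vy - potential (lastOf (inner i)) ≡ - + quot i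
    last-edge-drop i = begin
      0ℤ - potential (lastOf (inner i))                      ≡⟨ cong (_-_ 0ℤ) (lastOf-value potential (height i) (inner i) (potential-vx i) (potential-inner i)) ⟩
      0ℤ - (+ b - + len i * + quot i)                        ≡⟨ cong (λ t → 0ℤ - (t - + len i * + quot i)) (b≡suc-len*quot i) ⟩
      0ℤ - ((1ℤ + + len i) * + quot i - + len i * + quot i)  ≡⟨ last-step (+ len i) (+ quot i) ⟩
      - + quot i                                             ∎
      where
      open ≡-Reasoning
      last-step : ∀ l s → 0ℤ - ((1ℤ + l) * s - l * s) ≡ - s
      last-step = solve-∀

    potential-balanced : ∀ i j → laplacian potential (inner i j) ≡ 0ℤ
    potential-balanced i j = begin
      laplacian potential (inner i j)                                    ≡⟨ cong₂ (λ p q → (at-j - p) + ((at-j - q) + 0ℤ)) prev next ⟩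
      (at-j - height i (toℕ j)) + ((at-j - height i (2 ℕ.+ toℕ j)) + 0ℤ) ≡⟨ linear (+ b) (+ quot i) (+ toℕ j) ⟩
      0ℤ                                                                 ∎
      where
      open ≡-Reasoning
      at-j : ℤ
      at-j = height i (suc (toℕ j))
      prev : potential (prevOf j (inner i)) ≡ height i (toℕ j)
      prev = prevOf-value potential (height i) (inner i) (potential-vx i) (potential-inner i) j
      next : potential (nextOf j (inner i)) ≡ height i (2 ℕ.+ toℕ j)
      next = nextOf-value potential (height i) (inner i) (potential-inner i) (potential-vy i) j
      linear : ∀ a s t → ((a - (1ℤ + t) * s) - (a - t * s)) + (((a - (1ℤ + t) * s) - (a - (1ℤ + (1ℤ + t)) * s)) + 0ℤ) ≡ 0ℤ
      linear = solve-∀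

    laplacian-potential : ∀ v → (order · δxy) v - zeroDiv v ≡ laplacian potential v
    laplacian-potential vx = begin
      (order · δxy) vx - zeroDiv vx                                               ≡⟨ multiple-δxy-vx order ⟩
      + b + + sumFin n quot                                                       ≡⟨ cong₂ _+_ (ℤₚ.+-identityʳ (+ b)) (sumℤ-pos first-edge-drop (allFin n)) ⟨
      (+ b - 0ℤ) + sumℤ (λ i → potential vx - potential (firstOf (inner i))) (allFin n) ≡⟨ laplacian-vx potential ⟨
      laplacian potential vx                                                      ∎
      where open ≡-Reasoning
    laplacian-potential vy = begin
      (order · δxy) vy - zeroDiv vy                                              ≡⟨ multiple-δxy-vy order ⟩
      - (+ b + + sumFin n quot)                                                  ≡⟨ ℤₚ.neg-distrib-+ (+ b) (+ sumFin n quot) ⟩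
      - + b + - + sumFin n quot                                                  ≡⟨ cong₂ _+_ (ℤₚ.+-identityˡ (- + b)) (sumℤ-neg last-edge-drop (allFin n)) ⟨
      (0ℤ - + b) + sumℤ (λ i → potential vy - potential (lastOf (inner i))) (allFin n) ≡⟨ laplacian-vy potential ⟨
      laplacian potential vy                                                     ∎
      where open ≡-Reasoning
    laplacian-potential (inner i j) = trans (multiple-δxy-inner order i j) (sym (potential-balanced i j))

    order-minimal : ∀ m → 0 < m → (m · δxy) ∼ zeroDiv → order ≤ m
    order-minimal m 0<m (g , m·δxy≡Lg) = lcm+Σquot-least (g vx - g vy) slope drop≡c*slope m≡Lg-vx 0<m
      where
      open ≡-Reasoning
      slope : Fin n → ℤ
      slope i = g vx - g (firstOf (inner i))
      harmonic : ∀ i j → Balanced g (prevFrom vx j (inner i)) (inner i j) (nextOf j (inner i))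
      harmonic i j = subst (λ p → Balanced g p (inner i j) (nextOf j (inner i))) (prevOf≡prevFrom-vx j (inner i))
                           (trans (sym (m·δxy≡Lg (inner i j))) (multiple-δxy-inner m i j))
      drop≡c*slope : ∀ i → g vx - g vy ≡ + c i * slope i
      drop≡c*slope i = begin
        g vx - g vy                               ≡⟨ cong (_-_ (g vx)) (balanced-path-drop g vx (inner i) (harmonic i)) ⟩
        g vx - (g vx - + suc (len i) * slope i)   ≡⟨ cancel (g vx) (+ suc (len i) * slope i) ⟩
        + suc (len i) * slope i                   ≡⟨ cong (λ l → + l * slope i) (suc-len i) ⟩
        + c i * slope i                           ∎
        where
        cancel : ∀ a x → a - (a - x) ≡ x
        cancel = solve-∀
      m≡Lg-vx : + m ≡ (g vx - g vy) + sumℤ slope (allFin n)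
      m≡Lg-vx = trans (sym (multiple-δxy-vx m)) (trans (m·δxy≡Lg vx) (laplacian-vx g))

    δxy-order : IsOrder δxy order
    δxy-order = ℕₚ.<-≤-trans (ℕ.>-nonZero⁻¹ b {{b≢0}}) (ℕₚ.m≤m+n b (sumFin n quot))
              , (potential , laplacian-potential)
              , order-minimal

open import Data.Nat using (_+_)

-- The hypothesis 2 ≤ n is unused: the formula holds for every n.
proposition4p2 : (n : ℕ) → 2 ≤ n → (k : Fin n → ℕ) → (h : ∀ i → 3 ≤ k i) →
    let b = lcmFin n (λ i → k i Data.Nat.∸ 1) in
    Hinge.IsOrder n k (Hinge.δxy n k)
      (b + sumFin n (λ i → (b / (k i Data.Nat.∸ 1)) {{pred-nonZero (h i)}}))
proposition4p2 n _ k h = HingeDivisors.δxy-order n k h
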